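{- For every positive integer $n$, $$\sum_{k=0}^{n}\binom{2n}{k}\binom{2n+1}{k}+\sum_{k=n+1}^{2n+1}\binom{2n}{k-1}\binom{2n+1}{k}=\binom{4n+1}{2n}+\binom{2n}{n}^2.$$ -}

module Defs where

open import Data.Nat using (ℕ; zero; suc; _+_; _∸_)

sumFrom : ℕ → ℕ → (ℕ → ℕ) → ℕ
sumFrom a zero    f = 0
sumFrom a (suc m) f = f a + sumFrom (suc a) m f

sumRange : ℕ → ℕ → (ℕ → ℕ) → ℕ
sumRange a b f = sumFrom a (suc b ∸ a) f

module Submission where

-- Put N = n + m (the theorem is the case m = n, N = 2n)
-- and write c k = C(N,k), c⁻ k = C(N,k-1) (zero for k = 0).  Pascal's rule
-- C(N+1,k) = c k + c⁻ k splits every term of both sums into a square and an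
-- "adjacent" product c⁻ k · c k:
--   * the squares cover k = 0..n and k = n..N, i.e. all of 0..N once and
--     the middle index n twice;
--   * the adjacent products cover k = 0..n and k = n+1..N+1, i.e. 0..N+1.
-- By Vandermonde's convolution (and the symmetry C(N,N-k) = C(N,k)) these
-- full sums are C(2N,N) and C(2N,N-1), and Pascal's rule once more gives
-- C(2N+1,N) + C(N,n)².

open import Defs
open import Data.Nat using (ℕ; zero; suc; _+_; _*_; _∸_; _≤_; _<_; z≤n; s≤s)
open import Data.Nat.Combinatorics
  using (_C_; nCk+nC[k+1]≡[n+1]C[k+1]; nCk≡nC[n∸k]; k>n⇒nCk≡0)
open import Data.Nat.Properties
open import Data.Nat.Tactic.RingSolver using (solve-∀)
open import Algebra.Properties.CommutativeSemigroup +-commutativeSemigroup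
  using (interchange; x∙yz≈xz∙y; xy∙z≈xz∙y)
open import Relation.Binary.PropositionalEquality
open ≡-Reasoning

sumFrom-shift : ∀ a m (f : ℕ → ℕ) →
  sumFrom (suc a) m f ≡ sumFrom a m (λ k → f (suc k))
sumFrom-shift a zero    f = refl
sumFrom-shift a (suc m) f = cong (f (suc a) +_) (sumFrom-shift (suc a) m f)

sumFrom-cong< : ∀ a m (f g : ℕ → ℕ) →
  (∀ i → i < m → f (a + i) ≡ g (a + i)) → sumFrom a m f ≡ sumFrom a m g
sumFrom-cong< a zero    f g f≗g = refl
sumFrom-cong< a (suc m) f g f≗g = cong₂ _+_ first rest
  where
  first : f a ≡ g a
  first = subst (λ x → f x ≡ g x) (+-identityʳ a) (f≗g 0 (s≤s z≤n))
  rest : sumFrom (suc a) m f ≡ sumFrom (suc a) m g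
  rest = sumFrom-cong< (suc a) m f g λ i i<m →
    subst (λ x → f x ≡ g x) (+-suc a i) (f≗g (suc i) (s≤s i<m))

sumFrom-cong : ∀ a m {f g : ℕ → ℕ} → (∀ k → f k ≡ g k) →
  sumFrom a m f ≡ sumFrom a m g
sumFrom-cong a m {f} {g} f≗g = sumFrom-cong< a m f g (λ i _ → f≗g (a + i))

sumFrom-zero : ∀ a m → sumFrom a m (λ _ → 0) ≡ 0
sumFrom-zero a zero    = refl
sumFrom-zero a (suc m) = sumFrom-zero (suc a) m

sumFrom-+ : ∀ a m (f g : ℕ → ℕ) →
  sumFrom a m (λ k → f k + g k) ≡ sumFrom a m f + sumFrom a m g
sumFrom-+ a zero    f g = refl
sumFrom-+ a (suc m) f g = begin
  (f a + g a) + sumFrom (suc a) m (λ k → f k + g k)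
    ≡⟨ cong ((f a + g a) +_) (sumFrom-+ (suc a) m f g) ⟩
  (f a + g a) + (sumFrom (suc a) m f + sumFrom (suc a) m g)
    ≡⟨ interchange (f a) (g a) _ _ ⟩
  (f a + sumFrom (suc a) m f) + (g a + sumFrom (suc a) m g) ∎

sumFrom-++ : ∀ a m l (f : ℕ → ℕ) →
  sumFrom a (m + l) f ≡ sumFrom a m f + sumFrom (a + m) l f
sumFrom-++ a zero    l f = cong (λ x → sumFrom x l f) (sym (+-identityʳ a))
sumFrom-++ a (suc m) l f = begin
  f a + sumFrom (suc a) (m + l) f
    ≡⟨ cong (f a +_) (sumFrom-++ (suc a) m l f) ⟩
  f a + (sumFrom (suc a) m f + sumFrom (suc a + m) l f)
    ≡⟨ cong (λ x → f a + (sumFrom (suc a) m f + sumFrom x l f)) (sym (+-suc a m)) ⟩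
  f a + (sumFrom (suc a) m f + sumFrom (a + suc m) l f)
    ≡⟨ sym (+-assoc (f a) _ _) ⟩
  (f a + sumFrom (suc a) m f) + sumFrom (a + suc m) l f ∎

sumFrom-snoc : ∀ a m (f : ℕ → ℕ) →
  sumFrom a (suc m) f ≡ sumFrom a m f + f (a + m)
sumFrom-snoc a m f = begin
  sumFrom a (suc m) f         ≡⟨ cong (λ t → sumFrom a t f) (+-comm 1 m) ⟩
  sumFrom a (m + 1) f         ≡⟨ sumFrom-++ a m 1 f ⟩
  sumFrom a m f + (f (a + m) + 0)
    ≡⟨ cong (sumFrom a m f +_) (+-identityʳ (f (a + m))) ⟩
  sumFrom a m f + f (a + m)   ∎

infixl 6.5 _C⁻_
_C⁻_ : ℕ → ℕ → ℕ
a C⁻ zero  = 0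
a C⁻ suc k = a C k

pascal : ∀ a k → suc a C k ≡ a C k + a C⁻ k
pascal a zero    = refl
pascal a (suc k) = trans (sym (nCk+nC[k+1]≡[n+1]C[k+1] a k)) (+-comm (a C k) (a C suc k))

-- Vandermonde's convolution  Σ_{k=0}^{m} C(a,k) C(b,m-k) = C(a+b,m),  proved
-- by induction on a simultaneously with its shifted form (Σ C(a,k-1) C(b,m-k)
-- = C(a+b,m-1)), which is the other half of the Pascal split of C(a+1,k).
vandermonde  : ∀ a b m →
  sumFrom 0 (suc m) (λ k → (a C k) * (b C (m ∸ k))) ≡ (a + b) C m
vandermonde⁻ : ∀ a b m →
  sumFrom 0 (suc m) (λ k → (a C⁻ k) * (b C (m ∸ k))) ≡ (a + b) C⁻ m

vandermonde⁻ a b zero    = refl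
vandermonde⁻ a b (suc m) = trans (sumFrom-shift 0 (suc m) _) (vandermonde a b m)

vandermonde zero b m = begin
  1 * (b C m) + sumFrom 1 m (λ k → (0 C k) * (b C (m ∸ k)))
    ≡⟨ cong₂ _+_ (*-identityˡ (b C m)) (trans (sumFrom-shift 0 m _) (sumFrom-zero 0 m)) ⟩
  b C m + 0
    ≡⟨ +-identityʳ (b C m) ⟩
  b C m ∎
vandermonde (suc a) b m = begin
  sumFrom 0 (suc m) (λ k → (suc a C k) * other k)
    ≡⟨ sumFrom-cong 0 (suc m) pascalSplit ⟩
  sumFrom 0 (suc m) (λ k → (a C k) * other k + (a C⁻ k) * other k)
    ≡⟨ sumFrom-+ 0 (suc m) (λ k → (a C k) * other k) (λ k → (a C⁻ k) * other k) ⟩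
  sumFrom 0 (suc m) (λ k → (a C k) * other k) + sumFrom 0 (suc m) (λ k → (a C⁻ k) * other k)
    ≡⟨ cong₂ _+_ (vandermonde a b m) (vandermonde⁻ a b m) ⟩
  (a + b) C m + (a + b) C⁻ m
    ≡⟨ sym (pascal (a + b) m) ⟩
  suc (a + b) C m ∎
  where
  other : ℕ → ℕ
  other k = b C (m ∸ k)
  pascalSplit : ∀ k → (suc a C k) * other k ≡ (a C k) * other k + (a C⁻ k) * other k
  pascalSplit k = trans (cong (_* other k) (pascal a k)) (*-distribʳ-+ (other k) (a C k) (a C⁻ k))

reflect : ∀ N (g : ℕ → ℕ) →
  sumFrom 0 (suc N) (λ k → g k * (N C (N ∸ k))) ≡ sumFrom 0 (suc N) (λ k → g k * (N C k))
reflect N g = sumFrom-cong< 0 (suc N) _ _ λ k k<1+N →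
  cong (g k *_) (sym (nCk≡nC[n∸k] (≤-pred k<1+N)))

squareSum : ∀ N → sumFrom 0 (suc N) (λ k → (N C k) * (N C k)) ≡ (N + N) C N
squareSum N = trans (sym (reflect N (N C_))) (vandermonde N N N)

adjacentSum : ∀ N →
  sumFrom 0 (suc (suc N)) (λ k → (N C⁻ k) * (N C k)) ≡ (N + N) C⁻ N
adjacentSum N = begin
  sumFrom 0 (suc (suc N)) adjacent
    ≡⟨ sumFrom-snoc 0 (suc N) adjacent ⟩
  sumFrom 0 (suc N) adjacent + (N C N) * (N C suc N)
    ≡⟨ cong (λ x → sumFrom 0 (suc N) adjacent + (N C N) * x) (k>n⇒nCk≡0 (n<1+n N)) ⟩
  sumFrom 0 (suc N) adjacent + (N C N) * 0
    ≡⟨ trans (cong (sumFrom 0 (suc N) adjacent +_) (*-zeroʳ (N C N))) (+-identityʳ _) ⟩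
  sumFrom 0 (suc N) adjacent
    ≡⟨ trans (sym (reflect N (N C⁻_))) (vandermonde⁻ N N N) ⟩
  (N + N) C⁻ N ∎
  where
  adjacent : ℕ → ℕ
  adjacent k = (N C⁻ k) * (N C k)

splitSumIdentity : ∀ n m →
  sumFrom 0 (suc n) (λ k → ((n + m) C k) * (suc (n + m) C k))
    + sumFrom (suc n) (suc m) (λ k → ((n + m) C (k ∸ 1)) * (suc (n + m) C k))
  ≡ suc ((n + m) + (n + m)) C (n + m) + ((n + m) C n) * ((n + m) C n)
splitSumIdentity n m = begin
  sumFrom 0 (suc n) (λ k → (N C k) * (suc N C k))
    + sumFrom (suc n) (suc m) (λ k → (N C (k ∸ 1)) * (suc N C k))
    ≡⟨ cong₂ _+_ firstSum secondSum ⟩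
  (squaresA + adjacentA) + (squaresB + adjacentB)
    ≡⟨ interchange squaresA adjacentA squaresB adjacentB ⟩
  (squaresA + squaresB) + (adjacentA + adjacentB)
    ≡⟨ cong₂ _+_ squares adjacents ⟩
  ((N + N) C N + square n) + (N + N) C⁻ N
    ≡⟨ xy∙z≈xz∙y ((N + N) C N) (square n) ((N + N) C⁻ N) ⟩
  ((N + N) C N + (N + N) C⁻ N) + square n
    ≡⟨ cong (_+ square n) (sym (pascal (N + N) N)) ⟩
  suc (N + N) C N + square n ∎
  where
  N : ℕ
  N = n + m
  square adjacent : ℕ → ℕ
  square   k = (N C k) * (N C k)
  adjacent k = (N C⁻ k) * (N C k)
  squaresA adjacentA squaresB adjacentB : ℕ
  squaresA  = sumFrom 0 (suc n) square
  adjacentA = sumFrom 0 (suc n) adjacent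
  squaresB  = sumFrom n (suc m) square
  adjacentB = sumFrom (suc n) (suc m) adjacent

  firstSum : sumFrom 0 (suc n) (λ k → (N C k) * (suc N C k)) ≡ squaresA + adjacentA
  firstSum = trans (sumFrom-cong 0 (suc n) λ k → begin
      (N C k) * (suc N C k)          ≡⟨ cong ((N C k) *_) (pascal N k) ⟩
      (N C k) * (N C k + N C⁻ k)     ≡⟨ *-distribˡ-+ (N C k) (N C k) (N C⁻ k) ⟩
      square k + (N C k) * (N C⁻ k)  ≡⟨ cong (square k +_) (*-comm (N C k) (N C⁻ k)) ⟩
      square k + adjacent k          ∎)
    (sumFrom-+ 0 (suc n) square adjacent)

  secondSum : sumFrom (suc n) (suc m) (λ k → (N C (k ∸ 1)) * (suc N C k))
            ≡ squaresB + adjacentB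
  secondSum = begin
    sumFrom (suc n) (suc m) (λ k → (N C (k ∸ 1)) * (suc N C k))
      ≡⟨ sumFrom-shift n (suc m) _ ⟩
    sumFrom n (suc m) (λ j → (N C j) * (suc N C suc j))
      ≡⟨ sumFrom-cong n (suc m) (λ j → begin
           (N C j) * (suc N C suc j)      ≡⟨ cong ((N C j) *_) (pascal N (suc j)) ⟩
           (N C j) * (N C suc j + N C j)  ≡⟨ *-distribˡ-+ (N C j) (N C suc j) (N C j) ⟩
           adjacent (suc j) + square j    ≡⟨ +-comm (adjacent (suc j)) (square j) ⟩
           square j + adjacent (suc j)    ∎) ⟩
    sumFrom n (suc m) (λ j → square j + adjacent (suc j))
      ≡⟨ sumFrom-+ n (suc m) square (λ j → adjacent (suc j)) ⟩
    squaresB + sumFrom n (suc m) (λ j → adjacent (suc j))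
      ≡⟨ cong (squaresB +_) (sym (sumFrom-shift n (suc m) adjacent)) ⟩
    squaresB + adjacentB ∎

  -- The squares cover 0..N once and the index n a second time.
  squares : squaresA + squaresB ≡ (N + N) C N + square n
  squares = begin
    squaresA + (square n + sumFrom (suc n) m square)
      ≡⟨ x∙yz≈xz∙y squaresA (square n) _ ⟩
    (squaresA + sumFrom (suc n) m square) + square n
      ≡⟨ cong (_+ square n) (sym (sumFrom-++ 0 (suc n) m square)) ⟩
    sumFrom 0 (suc N) square + square n
      ≡⟨ cong (_+ square n) (squareSum N) ⟩
    (N + N) C N + square n ∎

  adjacents : adjacentA + adjacentB ≡ (N + N) C⁻ N
  adjacents = begin
    adjacentA + adjacentB
      ≡⟨ sym (sumFrom-++ 0 (suc n) (suc m) adjacent) ⟩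
    sumFrom 0 (suc n + suc m) adjacent
      ≡⟨ cong (λ t → sumFrom 0 (suc t) adjacent) (+-suc n m) ⟩
    sumFrom 0 (suc (suc N)) adjacent
      ≡⟨ adjacentSum N ⟩
    (N + N) C⁻ N ∎

theoremSums : ℕ → ℕ → ℕ
theoremSums n N =
  sumRange 0 n (λ k → (N C k) * ((N + 1) C k))
  + sumRange (n + 1) (N + 1) (λ k → (N C (k ∸ 1)) * ((N + 1) C k))

termCount : ∀ n → suc (n + n) ∸ n ≡ suc n
termCount n = trans (cong (_∸ n) (sym (+-suc n n))) (m+n∸m≡n n (suc n))

theoremSums-normalForm : ∀ n →
  theoremSums n (n + n)
  ≡ sumFrom 0 (suc n) (λ k → ((n + n) C k) * (suc (n + n) C k))
    + sumFrom (suc n) (suc n) (λ k → ((n + n) C (k ∸ 1)) * (suc (n + n) C k))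
theoremSums-normalForm n rewrite +-comm (n + n) 1 | +-comm n 1 =
  cong (λ t → sumFrom 0 (suc n) (λ k → ((n + n) C k) * (suc (n + n) C k))
            + sumFrom (suc n) t (λ k → ((n + n) C (k ∸ 1)) * (suc (n + n) C k)))
       (termCount n)

twice : ∀ n → 2 * n ≡ n + n
twice = solve-∀

fourTimesPlusOne : ∀ n → 4 * n + 1 ≡ suc ((n + n) + (n + n))
fourTimesPlusOne = solve-∀

-- The theorem is the case m = n (N = 2n) of splitSumIdentity.
mainTheorem2 : (n : ℕ) → 1 ≤ n →
    sumRange 0 n (λ k → ((2 * n) C k) * ((2 * n + 1) C k))
    + sumRange (n + 1) (2 * n + 1) (λ k → ((2 * n) C (k ∸ 1)) * ((2 * n + 1) C k))
    ≡ ((4 * n + 1) C (2 * n)) + ((2 * n) C n) * ((2 * n) C n)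
mainTheorem2 n _ = begin
  theoremSums n (2 * n)
    ≡⟨ cong (theoremSums n) (twice n) ⟩
  theoremSums n (n + n)
    ≡⟨ theoremSums-normalForm n ⟩
  _ ≡⟨ splitSumIdentity n n ⟩
  suc ((n + n) + (n + n)) C (n + n) + ((n + n) C n) * ((n + n) C n)
    ≡⟨ cong₂ (λ a N → a C N + (N C n) * (N C n)) (sym (fourTimesPlusOne n)) (sym (twice n)) ⟩
  ((4 * n + 1) C (2 * n)) + ((2 * n) C n) * ((2 * n) C n) ∎
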